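{- For every integer $k\ge 2$, the sequence $\{L_n^{(k)}\}_{n\in\mathbb{Z}}$ is periodic modulo $2$ with period $k+1$; that is, $L_{n}^{(k)}\equiv L_{n-(k+1)}^{(k)}\pmod 2$ for all $n\in\mathbb{Z}$.
   Context: For an integer $k\ge 2$, the $k$-generalized Lucas sequence is defined by $L_{2-k}^{(k)}=\cdots=L_{ -1}^{(k)}=0$, $L_0^{(k)}=2$, $L_1^{(k)}=1$, and the recurrence $L_n^{(k)}=L_{n-1}^{(k)}+L_{n-2}^{(k)}+\cdots+L_{n-k}^{(k)}$; the recurrence is used (forwards and backwards) to define $L_n^{(k)}$ for all $n\in\mathbb{Z}$. -}

module Defs where

open import Data.Nat using (ℕ; zero; suc)
open import Data.Integer using (ℤ; +_; -[1+_]; _+_; _-_; 0ℤ)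
open import Data.List using (List; []; _∷_; _++_; [_]; replicate; reverse; foldr)

sumℤ : List ℤ → ℤ
sumℤ = foldr _+_ 0ℤ

-- A "window" is the list of k consecutive values (L_j, L_{j+1}, ..., L_{j+k-1}).

fwd : List ℤ → List ℤ
fwd [] = []
fwd (x ∷ xs) = xs ++ [ x + sumℤ xs ]

-- shift the window one step backward, using the recurrence backwards:
-- L_{j-1} = L_{j+k-1} - (L_j + ... + L_{j+k-2})
bwd : List ℤ → List ℤ
bwd w with reverse w
... | [] = []
... | y ∷ rs = (y - sumℤ rs) ∷ reverse rs

iter : (List ℤ → List ℤ) → ℕ → List ℤ → List ℤ
iter f zero w = w
iter f (suc m) w = f (iter f m w)

headℤ : List ℤ → ℤ
headℤ [] = 0ℤ
headℤ (x ∷ _) = x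

-- initial window at index 2-k: (L_{2-k},...,L_{-1},L_0,L_1) = (0,...,0,2,1)
base : ℕ → List ℤ
base k = replicate (k Data.Nat.∸ 2) 0ℤ ++ (+ 2 ∷ + 1 ∷ [])

-- window starting at index 2-k+d (d an integer)
window : ℕ → ℤ → List ℤ
window k (+ m) = iter fwd m (base k)
window k -[1+ m ] = iter bwd (suc m) (base k)

-- k-generalized Lucas number L_n^{(k)}, n ∈ ℤ (meaningful for k ≥ 2)
L : ℕ → ℤ → ℤ
L k n = headℤ (window k (n - (+ 2 - + k)))

-- Subtracting the recurrence at n − 1 from the one at n leaves
-- L_n − L_{n−1} = L_{n−1} − L_{n−k−1}, i.e. L_n + L_{n−k−1} = 2 L_{n−1}.
-- On windows: k + 1 forward steps from a window w produce the head
-- 2·(sum w) − head w, because each step maps the window sum s to 2s − head.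
module Submission where

open import Defs
open import Data.Nat using (ℕ; _≤_; zero; suc; _∸_) renaming (_+_ to _+ℕ_)
import Data.Nat.Properties as ℕ
open import Data.Integer using (ℤ; +_; -[1+_]; _-_; _+_; _*_; 0ℤ)
import Data.Integer.Properties as ℤ
open import Data.Integer.Divisibility using (_∣_)
open import Data.Integer.Divisibility.Signed using (divides; ∣⇒∣ᵤ)
open import Data.Integer.Tactic.RingSolver using (solve-∀)
open import Data.List using (List; []; _∷_; _++_; [_]; length; replicate; reverse)
import Data.List.Properties as List
open import Function using (_∘_)
open import Relation.Binary.PropositionalEquality
  using (_≡_; refl; sym; trans; cong; cong₂; module ≡-Reasoning)
open ≡-Reasoning

sumℤ-++ : ∀ xs ys → sumℤ (xs ++ ys) ≡ sumℤ xs + sumℤ ys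
sumℤ-++ []       ys = sym (ℤ.+-identityˡ (sumℤ ys))
sumℤ-++ (x ∷ xs) ys = trans (cong (λ t → x + t) (sumℤ-++ xs ys)) (sym (ℤ.+-assoc x (sumℤ xs) (sumℤ ys)))

sumℤ-reverse : ∀ xs → sumℤ (reverse xs) ≡ sumℤ xs
sumℤ-reverse []       = refl
sumℤ-reverse (x ∷ xs) = begin
  sumℤ (reverse (x ∷ xs))       ≡⟨ cong sumℤ (List.unfold-reverse x xs) ⟩
  sumℤ (reverse xs ++ [ x ])    ≡⟨ sumℤ-++ (reverse xs) [ x ] ⟩
  sumℤ (reverse xs) + (x + 0ℤ)  ≡⟨ cong₂ _+_ (sumℤ-reverse xs) (ℤ.+-identityʳ x) ⟩
  sumℤ xs + x                   ≡⟨ ℤ.+-comm (sumℤ xs) x ⟩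
  x + sumℤ xs                   ∎

iter-suc : ∀ (f : List ℤ → List ℤ) m w → iter f (suc m) w ≡ iter f m (f w)
iter-suc f zero    w = refl
iter-suc f (suc m) w = cong f (iter-suc f m w)

length-iter : ∀ f → (∀ w → length (f w) ≡ length w) →
              ∀ m w → length (iter f m w) ≡ length w
length-iter f f-len zero    w = refl
length-iter f f-len (suc m) w = trans (f-len (iter f m w)) (length-iter f f-len m w)

fwd-bwd : ∀ w → fwd (bwd w) ≡ w
fwd-bwd w with reverse w in eq
... | [] = trans (cong reverse (sym eq)) (List.reverse-involutive w)
... | y ∷ rs = begin
  reverse rs ++ [ (y - sumℤ rs) + sumℤ (reverse rs) ]
    ≡⟨ cong (λ z → reverse rs ++ [ (y - sumℤ rs) + z ]) (sumℤ-reverse rs) ⟩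
  reverse rs ++ [ (y - sumℤ rs) + sumℤ rs ]
    ≡⟨ cong (λ z → reverse rs ++ [ z ]) (minus-plus y (sumℤ rs)) ⟩
  reverse rs ++ [ y ]  ≡⟨ List.unfold-reverse y rs ⟨
  reverse (y ∷ rs)     ≡⟨ cong reverse eq ⟨
  reverse (reverse w)  ≡⟨ List.reverse-involutive w ⟩
  w                    ∎
  where
  minus-plus : ∀ y s → (y - s) + s ≡ y
  minus-plus = solve-∀

length-fwd : ∀ w → length (fwd w) ≡ length w
length-fwd []       = refl
length-fwd (x ∷ xs) = trans (List.length-++ xs) (ℕ.+-comm (length xs) 1)

length-bwd : ∀ w → length (bwd w) ≡ length w
length-bwd w = trans (sym (length-fwd (bwd w))) (cong length (fwd-bwd w))

sumℤ-fwd : ∀ w → sumℤ (fwd w) + headℤ w ≡ sumℤ w + sumℤ w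
sumℤ-fwd []       = refl
sumℤ-fwd (x ∷ xs) = begin
  sumℤ (xs ++ [ s ]) + x      ≡⟨ cong (_+ x) (sumℤ-++ xs [ s ]) ⟩
  sumℤ xs + (s + 0ℤ) + x      ≡⟨ rearrange x (sumℤ xs) ⟩
  s + s                       ∎
  where
  s = x + sumℤ xs
  rearrange : ∀ x t → t + ((x + t) + 0ℤ) + x ≡ (x + t) + (x + t)
  rearrange = solve-∀

orbit : List ℤ → ℕ → ℤ
orbit w m = headℤ (iter fwd m w)

orbit-++ : ∀ xs y ys → orbit (xs ++ y ∷ ys) (length xs) ≡ y
orbit-++ []       y ys = refl
orbit-++ (x ∷ xs) y ys = begin
  headℤ (iter fwd (suc (length xs)) (x ∷ xs ++ y ∷ ys))
    ≡⟨ cong headℤ (iter-suc fwd (length xs) (x ∷ xs ++ y ∷ ys)) ⟩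
  headℤ (iter fwd (length xs) ((xs ++ y ∷ ys) ++ [ s ]))
    ≡⟨ cong (headℤ ∘ iter fwd (length xs)) (List.++-assoc xs (y ∷ ys) [ s ]) ⟩
  orbit (xs ++ y ∷ ys ++ [ s ]) (length xs)
    ≡⟨ orbit-++ xs y (ys ++ [ s ]) ⟩
  y ∎
  where s = x + sumℤ (xs ++ y ∷ ys)

orbit-length : ∀ w → orbit w (length w) ≡ sumℤ w
orbit-length []       = refl
orbit-length (x ∷ xs) =
  trans (cong headℤ (iter-suc fwd (length xs) (x ∷ xs))) (orbit-++ xs (x + sumℤ xs) [])

orbit-suc-length : ∀ w → orbit w (suc (length w)) + orbit w 0 ≡ + 2 * orbit w (length w)
orbit-suc-length w = begin
  orbit w (suc (length w)) + headℤ w       ≡⟨ cong (λ v → headℤ v + headℤ w) (iter-suc fwd (length w) w) ⟩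
  orbit (fwd w) (length w) + headℤ w       ≡⟨ cong (λ m → orbit (fwd w) m + headℤ w) (length-fwd w) ⟨
  orbit (fwd w) (length (fwd w)) + headℤ w ≡⟨ cong (_+ headℤ w) (orbit-length (fwd w)) ⟩
  sumℤ (fwd w) + headℤ w                   ≡⟨ sumℤ-fwd w ⟩
  sumℤ w + sumℤ w                          ≡⟨ double (sumℤ w) ⟨
  + 2 * sumℤ w                             ≡⟨ cong (λ t → + 2 * t) (orbit-length w) ⟨
  + 2 * orbit w (length w)                 ∎
  where
  double : ∀ s → + 2 * s ≡ s + s
  double = solve-∀

window-suc : ∀ k d → window k (d + + 1) ≡ fwd (window k d)
window-suc k (+ m) = cong (λ j → iter fwd j (base k)) (ℕ.+-comm m 1)
window-suc k -[1+ zero ]  = sym (fwd-bwd (base k))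
window-suc k -[1+ suc m ] = sym (fwd-bwd (iter bwd (suc m) (base k)))

window-+ : ∀ k d j → window k (d + + j) ≡ iter fwd j (window k d)
window-+ k d zero    = cong (window k) (ℤ.+-identityʳ d)
window-+ k d (suc j) = begin
  window k (d + + suc j)       ≡⟨ cong (λ m → window k (d + + m)) (ℕ.+-comm j 1) ⟨
  window k (d + (+ j + + 1))   ≡⟨ cong (window k) (ℤ.+-assoc d (+ j) (+ 1)) ⟨
  window k ((d + + j) + + 1)   ≡⟨ window-suc k (d + + j) ⟩
  fwd (window k (d + + j))     ≡⟨ cong fwd (window-+ k d j) ⟩
  iter fwd (suc j) (window k d) ∎

length-base : ∀ k → 2 ≤ k → length (base k) ≡ k
length-base k 2≤k = begin
  length (replicate (k ∸ 2) 0ℤ ++ + 2 ∷ + 1 ∷ []) ≡⟨ List.length-++ (replicate (k ∸ 2) 0ℤ) ⟩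
  length (replicate (k ∸ 2) 0ℤ) +ℕ 2               ≡⟨ cong (_+ℕ 2) (List.length-replicate (k ∸ 2)) ⟩
  (k ∸ 2) +ℕ 2                                     ≡⟨ ℕ.m∸n+n≡m 2≤k ⟩
  k                                                ∎

length-window : ∀ k → 2 ≤ k → ∀ d → length (window k d) ≡ k
length-window k 2≤k (+ m)    = trans (length-iter fwd length-fwd m (base k)) (length-base k 2≤k)
length-window k 2≤k -[1+ m ] = trans (length-iter bwd length-bwd (suc m) (base k)) (length-base k 2≤k)

2∣-if-sum≡2* : ∀ a b c → a + b ≡ + 2 * c → + 2 ∣ a - b
2∣-if-sum≡2* a b c a+b≡2c = ∣⇒∣ᵤ (divides (c - b) (begin
  a - b                  ≡⟨ regroup a b ⟩
  (a + b) - (b + b)      ≡⟨ cong (_- (b + b)) a+b≡2c ⟩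
  + 2 * c - (b + b)      ≡⟨ factor c b ⟩
  (c - b) * + 2          ∎))
  where
  regroup : ∀ a b → a - b ≡ (a + b) - (b + b)
  regroup = solve-∀
  factor : ∀ c b → + 2 * c - (b + b) ≡ (c - b) * + 2
  factor = solve-∀

lemma2p1 : (k : ℕ) → 2 ≤ k → (n : ℤ) →
    (+ 2) ∣ (L k n - L k (n - + (Data.Nat.suc k)))
lemma2p1 k 2≤k n = 2∣-if-sum≡2* (L k n) (L k (n - + suc k)) (orbit W k) recurrence
  where
  d : ℤ
  d = (n - + suc k) - (+ 2 - + k)
  W : List ℤ
  W = window k d
  shift : ∀ n a b c → n - (a - b) ≡ ((n - c) - (a - b)) + c
  shift = solve-∀
  L-orbit : L k n ≡ orbit W (suc k)
  L-orbit = cong headℤ (trans (cong (window k) (shift n (+ 2) (+ k) (+ suc k))) (window-+ k d (suc k)))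
  recurrence : L k n + orbit W 0 ≡ + 2 * orbit W k
  recurrence = begin
    L k n + orbit W 0                      ≡⟨ cong (_+ orbit W 0) L-orbit ⟩
    orbit W (suc k) + orbit W 0            ≡⟨ cong (λ m → orbit W (suc m) + orbit W 0) (length-window k 2≤k d) ⟨
    orbit W (suc (length W)) + orbit W 0   ≡⟨ orbit-suc-length W ⟩
    + 2 * orbit W (length W)               ≡⟨ cong (λ m → + 2 * orbit W m) (length-window k 2≤k d) ⟩
    + 2 * orbit W k                        ∎
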